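{- For an integer $h\ge1$ let $\mathcal{D}_h$ be the set of Dyck paths of height at most $h$, and for a Dyck path $\pi$ let $n(\pi)$ be half its number of steps, $m(\pi)$ the sum of the starting heights of its $(1,1)$ steps, $u(\pi)$ the number of its vertices on the line $y=0$ other than $(0,0)$, and $v(\pi)$ the number of its vertices on the line $y=h$; let $D_h(a,b;q,t)=\sum_{\pi\in\mathcal{D}_h} a^{u(\pi)}b^{v(\pi)}q^{m(\pi)}t^{n(\pi)}$. Define polynomials $Q_h(a,b;q,t)$ for $h\ge1$ by $Q_1(a,b;q,t)=1-abt$, $Q_2(a,b;q,t)=1-at-bqt$, and for $h\geq3$, $$Q_h(a,b;q,t)=Q_{h-1}(a,1;q,t)-bq^{h-1}t\,Q_{h-2}(a,1;q,t).$$ Then for all $h\ge1$, $$D_h(a,b;q,t)=\frac{Q_h(0,b;q,t)}{Q_h(a,b;q,t)}.$$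
   Context: A Dyck path is a walk on $\mathbb{Z}^2$ starting at $(0,0)$, with steps in directions $(1,1)$ and $(1,-1)$, having no vertex with negative $y$-coordinate, and ending on the line $y=0$ (the zero-step path is included). It has height at most $h$ if all its vertices lie between $y=0$ and $y=h$. $D_h$ is a formal power series in $t$; the identity is as formal power series in $t$. -}

module Defs where

open import Algebra.Bundles using (CommutativeRing)
open import Data.Nat using (ℕ; zero; suc; _∸_; _<ᵇ_; _≡ᵇ_)
open import Data.Bool using (Bool; true; false; if_then_else_; _∧_)
open import Data.List using (List; []; _∷_; map; _++_)

-- All step sequences of a given length; true = up step (1,1), false = down step (1,-1).
allSteps : ℕ → List (List Bool)
allSteps zero = [] ∷ []
allSteps (suc n) = map (true ∷_) (allSteps n) ++ map (false ∷_) (allSteps n)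

isDyck : ℕ → ℕ → List Bool → Bool
isDyck h y [] = y ≡ᵇ 0
isDyck h y (true ∷ s) = (y <ᵇ h) ∧ isDyck h (suc y) s
isDyck h zero (false ∷ s) = false
isDyck h (suc y) (false ∷ s) = isDyck h y s

module Dyck {c ℓ} (R : CommutativeRing c ℓ) where
  open CommutativeRing R

  infixr 8 _^_
  _^_ : Carrier → ℕ → Carrier
  x ^ zero = 1#
  x ^ suc n = x * (x ^ n)

  sumTo : ℕ → (ℕ → Carrier) → Carrier
  sumTo zero f = f 0
  sumTo (suc N) f = sumTo N f + f (suc N)

  sumList : List Carrier → Carrier
  sumList [] = 0#
  sumList (x ∷ xs) = x + sumList xs

  module _ (h : ℕ) (a b q : Carrier) where
    -- factor contributed by a vertex (other than (0,0)) at height y: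
    -- a if y = 0 (counts u), b if y = h (counts v)
    vertexFactor : ℕ → Carrier
    vertexFactor y = (if y ≡ᵇ 0 then a else 1#) * (if y ≡ᵇ h then b else 1#)

    -- a^{u} b^{v} q^{m} of the walk from height y with steps s
    -- (the start vertex (0,0) is not counted; for h ≥ 1 it is not at height h)
    weight : ℕ → List Bool → Carrier
    weight y [] = 1#
    weight y (true ∷ s) = (q ^ y) * (vertexFactor (suc y) * weight (suc y) s)
    weight y (false ∷ s) = vertexFactor (y ∸ 1) * weight (y ∸ 1) s

    -- coefficient of t^n in D_h(a,b;q,t): sum over Dyck paths with 2n steps, height ≤ h
    Dcoeff : ℕ → Carrier
    Dcoeff n = sumList (map (λ s → if isDyck h 0 s then weight 0 s else 0#) (allSteps (n Data.Nat.+ n)))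

  -- polynomials in t as coefficient functions
  shift : (ℕ → Carrier) → ℕ → Carrier
  shift f zero = 0#
  shift f (suc n) = f n

  -- Q h a b (with q fixed) : coefficient function of Q_h(a,b;q,t) in t
  Q : Carrier → ℕ → Carrier → Carrier → ℕ → Carrier
  Q q zero a b zero = 1#            -- Q_0 unused (h ≥ 1); set to 1
  Q q zero a b (suc n) = 0#
  Q q (suc zero) a b zero = 1#
  Q q (suc zero) a b (suc zero) = - (a * b)
  Q q (suc zero) a b (suc (suc n)) = 0#
  Q q (suc (suc zero)) a b zero = 1#
  Q q (suc (suc zero)) a b (suc zero) = - (a + b * q)
  Q q (suc (suc zero)) a b (suc (suc n)) = 0#
  Q q (suc (suc (suc k))) a b n =
    Q q (suc (suc k)) a 1# n - (b * q ^ suc (suc k)) * shift (Q q (suc k) a 1#) n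

  prodCoeff : (ℕ → Carrier) → (ℕ → Carrier) → ℕ → Carrier
  prodCoeff P D N = sumTo N (λ k → P k * D (N ∸ k))

-- A Dyck path of height at most h is a walk on {0,…,h} from 0 to 0 in which, with t marking up
-- steps, a step up from y weighs q^y times the vertex factor of y + 1 and a step down weighs the
-- vertex factor of its end.  For walks with arbitrary step weights u_y, d_y, let E_y be the series of
-- walks from y to 0 and K the continuant of the weights w_k = u_k d_k.  The products K_{h+1}·E_y
-- satisfy a linear recurrence that is triangular in (N, y), and so does d_0⋯d_{y-1}·K_{h-y}(w_{y+1},…),
-- whence K_{h+1}·E_0 = K_h(w_1,…): Flajolet's finite continued fraction.  For Dyck paths the weights
-- are a, q, q², …, q^{h-1} with the last one multiplied by b, and the recursion defining Q_h is the
-- expansion of a continuant along its last weight, so Q_h(a,b) = K_{h+1}.  Only w_0 involves a, and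
-- it vanishes at a = 0, hence K_h(w_1,…) = Q_h(0,b).

module Submission where

open import Defs
open import Algebra.Bundles using (CommutativeRing)
import Algebra.Properties.AbelianGroup as AbelianGroupProperties
import Algebra.Properties.CommutativeSemigroup as CommutativeSemigroupProperties
import Algebra.Properties.Group as GroupProperties
import Algebra.Properties.Ring as RingProperties
open import Data.Bool using (Bool; true; false; if_then_else_; T; _∧_)
open import Data.Empty using (⊥-elim)
open import Data.List using (List; []; _∷_; map; _++_)
open import Data.List.Properties using (map-++)
open import Data.Nat using (ℕ; zero; suc; _∸_; _≤_; _<_; _<ᵇ_; _≡ᵇ_; z≤n; s≤s)
import Data.Nat as Nat
import Data.Nat.Properties as ℕ
open import Function using (_∘_)
open import Relation.Binary.PropositionalEquality as ≡ using (_≡_)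
open import Relation.Nullary using (¬_; yes; no)

if-true : ∀ {a} {A : Set a} {b : Bool} {x y : A} → T b → (if b then x else y) ≡ x
if-true {b = true} _ = ≡.refl

if-false : ∀ {a} {A : Set a} {b : Bool} {x y : A} → ¬ T b → (if b then x else y) ≡ y
if-false {b = false} _ = ≡.refl
if-false {b = true} ¬b = ⊥-elim (¬b _)

drop : ∀ {a} {A : Set a} → ℕ → (ℕ → A) → ℕ → A
drop zero f = f
drop (suc y) f = drop y f ∘ suc

drop-apply : ∀ {a} {A : Set a} y (f : ℕ → A) k → drop y f k ≡ f (y Nat.+ k)
drop-apply zero f k = ≡.refl
drop-apply (suc y) f k = ≡.trans (drop-apply y f (suc k)) (≡.cong f (ℕ.+-suc y k))

drop-head : ∀ {a} {A : Set a} y (f : ℕ → A) → drop y f 0 ≡ f y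
drop-head y f = ≡.trans (drop-apply y f 0) (≡.cong f (ℕ.+-identityʳ y))

∸≡suc∸suc : ∀ {m n} → n < m → m ∸ n ≡ suc (m ∸ suc n)
∸≡suc∸suc {suc m} {zero} _ = ≡.refl
∸≡suc∸suc {suc m} {suc n} (s≤s n<m) = ∸≡suc∸suc n<m

module PowerSeries {c ℓ} (R : CommutativeRing c ℓ) where
  open CommutativeRing R
  open Dyck R
  open GroupProperties +-group using (ε⁻¹≈ε)
  open AbelianGroupProperties +-abelianGroup using (⁻¹-anti-homo‿-)
  open RingProperties ring using (x[y-z]≈xy-xz)
  open import Relation.Binary.Reasoning.Setoid setoid
  module +CS = CommutativeSemigroupProperties +-commutativeSemigroup
  module *CS = CommutativeSemigroupProperties *-commutativeSemigroup

  x-y≈x : ∀ x {y} → y ≈ 0# → x - y ≈ x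
  x-y≈x x y≈0 = trans (+-congˡ (trans (-‿cong y≈0) ε⁻¹≈ε)) (+-identityʳ x)

  x-y*0≈x : ∀ x y → x - y * 0# ≈ x
  x-y*0≈x x y = x-y≈x x (zeroʳ y)

  1ₛ : ℕ → Carrier
  1ₛ zero = 1#
  1ₛ (suc n) = 0#

  shift-cong : ∀ {F G : ℕ → Carrier} → (∀ n → F n ≈ G n) → ∀ n → shift F n ≈ shift G n
  shift-cong F≈G zero = refl
  shift-cong F≈G (suc n) = F≈G n

  shift-*ˡ : ∀ x (F : ℕ → Carrier) n → shift (λ m → x * F m) n ≈ x * shift F n
  shift-*ˡ x F zero = sym (zeroʳ x)
  shift-*ˡ x F (suc n) = refl

  shift-sub-* : ∀ (F : ℕ → Carrier) x (G : ℕ → Carrier) n →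
    shift (λ m → F m - x * G m) n ≈ shift F n - x * shift G n
  shift-sub-* F x G zero = sym (x-y*0≈x 0# x)
  shift-sub-* F x G (suc n) = refl

  sumTo-cong : ∀ N {f g : ℕ → Carrier} → (∀ k → k ≤ N → f k ≈ g k) → sumTo N f ≈ sumTo N g
  sumTo-cong zero f≈g = f≈g 0 z≤n
  sumTo-cong (suc N) f≈g =
    +-cong (sumTo-cong N (λ k k≤N → f≈g k (ℕ.m≤n⇒m≤1+n k≤N))) (f≈g (suc N) ℕ.≤-refl)

  sumTo-+ : ∀ N (f g : ℕ → Carrier) → sumTo N (λ k → f k + g k) ≈ sumTo N f + sumTo N g
  sumTo-+ zero f g = refl
  sumTo-+ (suc N) f g = trans (+-congʳ (sumTo-+ N f g)) (+CS.interchange _ _ _ _)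

  sumTo-*ˡ : ∀ N x (f : ℕ → Carrier) → sumTo N (λ k → x * f k) ≈ x * sumTo N f
  sumTo-*ˡ zero x f = refl
  sumTo-*ˡ (suc N) x f = trans (+-congʳ (sumTo-*ˡ N x f)) (sym (distribˡ x _ _))

  prodCoeff-congˡ : ∀ {P P' : ℕ → Carrier} (F : ℕ → Carrier) → (∀ n → P n ≈ P' n) →
    ∀ N → prodCoeff P F N ≈ prodCoeff P' F N
  prodCoeff-congˡ F P≈P' N = sumTo-cong N (λ k _ → *-congʳ (P≈P' k))

  prodCoeff-congʳ : ∀ (P : ℕ → Carrier) {F G : ℕ → Carrier} → (∀ n → F n ≈ G n) →
    ∀ N → prodCoeff P F N ≈ prodCoeff P G N
  prodCoeff-congʳ P F≈G N = sumTo-cong N (λ k _ → *-congˡ (F≈G (N ∸ k)))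

  prodCoeff-+ʳ : ∀ (P F G : ℕ → Carrier) N →
    prodCoeff P (λ n → F n + G n) N ≈ prodCoeff P F N + prodCoeff P G N
  prodCoeff-+ʳ P F G N = trans (sumTo-cong N (λ k _ → distribˡ (P k) _ _)) (sumTo-+ N _ _)

  prodCoeff-*ʳ : ∀ (P : ℕ → Carrier) x (F : ℕ → Carrier) N →
    prodCoeff P (λ n → x * F n) N ≈ x * prodCoeff P F N
  prodCoeff-*ʳ P x F N = trans (sumTo-cong N (λ k _ → *CS.x∙yz≈y∙xz (P k) x _)) (sumTo-*ˡ N x _)

  prodCoeff-shiftʳ : ∀ (P F : ℕ → Carrier) N → prodCoeff P (shift F) N ≈ shift (prodCoeff P F) N
  prodCoeff-shiftʳ P F zero = zeroʳ (P 0)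
  prodCoeff-shiftʳ P F (suc N) =
    trans (+-cong (sumTo-cong N (λ k k≤N → *-congˡ (reflexive (≡.cong (shift F) (ℕ.+-∸-assoc 1 k≤N)))))
                  (trans (*-congˡ (reflexive (≡.cong (shift F) (ℕ.n∸n≡0 N)))) (zeroʳ _)))
          (+-identityʳ _)

  prodCoeff-sucʳ : ∀ (P F : ℕ → Carrier) N →
    prodCoeff P F (suc N) ≈ prodCoeff P (F ∘ suc) N + P (suc N) * F 0
  prodCoeff-sucʳ P F N =
    +-cong (sumTo-cong N (λ k k≤N → *-congˡ (reflexive (≡.cong F (ℕ.+-∸-assoc 1 k≤N)))))
           (*-congˡ (reflexive (≡.cong F (ℕ.n∸n≡0 N))))

  -- continuant w (L + 1) and continuant (w ∘ suc) L are the denominator and the numerator of the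
  -- continued fraction 1 / (1 − w₀ t / (1 − w₁ t / ⋯ / (1 − w_{L−1} t))).
  continuant : (ℕ → Carrier) → ℕ → ℕ → Carrier
  continuant w zero n = 1ₛ n
  continuant w (suc zero) n = 1ₛ n
  continuant w (suc (suc L)) n =
    continuant (w ∘ suc) (suc L) n - w 0 * shift (continuant (w ∘ suc ∘ suc) L) n

  continuant-unfold : ∀ w L n → 1 ≤ L →
    continuant w (suc L) n ≡ continuant (w ∘ suc) L n - w 0 * shift (continuant (w ∘ suc ∘ suc) (L ∸ 1)) n
  continuant-unfold w (suc L) n _ = ≡.refl

  continuant-at-0 : ∀ w L → continuant w L 0 ≈ 1#
  continuant-at-0 w zero = refl
  continuant-at-0 w (suc zero) = refl
  continuant-at-0 w (suc (suc L)) = trans (x-y*0≈x _ _) (continuant-at-0 (w ∘ suc) (suc L))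

  continuant-cong : ∀ {w w' : ℕ → Carrier} L → (∀ j → suc j < L → w j ≈ w' j) →
    ∀ n → continuant w L n ≈ continuant w' L n
  continuant-cong zero w≈w' n = refl
  continuant-cong (suc zero) w≈w' n = refl
  continuant-cong (suc (suc L)) w≈w' n =
    +-cong (continuant-cong (suc L) (λ j j<L → w≈w' (suc j) (s≤s j<L)) n)
           (-‿cong (*-cong (w≈w' 0 (s≤s (s≤s z≤n)))
                           (shift-cong (continuant-cong L (λ j j<L → w≈w' (suc (suc j)) (s≤s (s≤s j<L)))) n)))

  continuant-head-0 : ∀ w L n → w 0 ≈ 0# → continuant w (suc (suc L)) n ≈ continuant (w ∘ suc) (suc L) n
  continuant-head-0 w L n w₀≈0 = x-y≈x _ (trans (*-congʳ w₀≈0) (zeroˡ _))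

  -[x*[y-z]]≈xz-xy : ∀ x y z → - (x * (y - z)) ≈ x * z - x * y
  -[x*[y-z]]≈xz-xy x y z = trans (-‿cong (x[y-z]≈xy-xz x y z)) (⁻¹-anti-homo‿- (x * y) (x * z))

  sub-exchange : ∀ A B C D u v → (A - u * B) - v * (C - u * D) ≈ (A - v * C) - u * (B - v * D)
  sub-exchange A B C D u v = begin
      (A - u * B) - v * (C - u * D)
    ≈⟨ +-congˡ (-[x*[y-z]]≈xz-xy v C (u * D)) ⟩
      (A - u * B) + (v * (u * D) - v * C)
    ≈⟨ +-congˡ (+-congʳ (*CS.x∙yz≈y∙xz v u D)) ⟩
      (A - u * B) + (u * (v * D) - v * C)
    ≈⟨ +CS.interchange A (- (u * B)) (u * (v * D)) (- (v * C)) ⟩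
      (A + u * (v * D)) + (- (u * B) - v * C)
    ≈⟨ +-congˡ (+-comm (- (u * B)) (- (v * C))) ⟩
      (A + u * (v * D)) + (- (v * C) - u * B)
    ≈⟨ +CS.interchange A (- (v * C)) (u * (v * D)) (- (u * B)) ⟨
      (A - v * C) + (u * (v * D) - u * B)
    ≈⟨ +-congˡ (-[x*[y-z]]≈xz-xy u B (v * D)) ⟨
      (A - v * C) - u * (B - v * D)
    ∎

  continuant-expandʳ : ∀ w L n →
    continuant w (suc (suc L)) n ≈ continuant w (suc L) n - w L * shift (continuant w L) n
  continuant-expandʳ w zero n = refl
  continuant-expandʳ w (suc zero) n = +CS.xy∙z≈xz∙y (1ₛ n) _ _
  continuant-expandʳ w (suc (suc L)) n = begin
      continuant (w ∘ suc) (suc (suc (suc L))) n - w 0 * shift (continuant (w ∘ suc ∘ suc) (suc (suc L))) n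
    ≈⟨ +-cong (continuant-expandʳ (w ∘ suc) (suc L) n)
              (-‿cong (*-congˡ (shift-cong (continuant-expandʳ (w ∘ suc ∘ suc) L) n))) ⟩
      (A - u * B) - w 0 * shift (λ m → C m - u * shift D m) n
    ≈⟨ +-congˡ (-‿cong (*-congˡ (shift-sub-* C u (shift D) n))) ⟩
      (A - u * B) - w 0 * (shift C n - u * shift (shift D) n)
    ≈⟨ sub-exchange A B (shift C n) (shift (shift D) n) u (w 0) ⟩
      (A - w 0 * shift C n) - u * (B - w 0 * shift (shift D) n)
    ≈⟨ +-congˡ (-‿cong (*-congˡ (shift-sub-* (continuant (w ∘ suc) (suc L)) (w 0) (shift D) n))) ⟨
      continuant w (suc (suc (suc L))) n - u * shift (continuant w (suc (suc L))) n
    ∎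
    where
    u = w (suc (suc L))
    A = continuant (w ∘ suc) (suc (suc L)) n
    B = shift (continuant (w ∘ suc) (suc L)) n
    C = continuant (w ∘ suc ∘ suc) (suc L)
    D = continuant (w ∘ suc ∘ suc) L

module BoundedWalks {c ℓ} (R : CommutativeRing c ℓ) where
  open CommutativeRing R
  open Dyck R
  open PowerSeries R
  open RingProperties ring using (x[y-z]≈xy-xz)
  open GroupProperties +-group using (//-rightDividesˡ)
  open import Relation.Binary.Reasoning.Setoid setoid

  -- E y N: the walks from height y to 0 with N up steps, split according to their first step.
  record IsWalkSeries (up down : ℕ → Carrier) (E : ℕ → ℕ → Carrier) : Set ℓ where
    field
      empty-walk : E 0 0 ≈ 1#
      up-from-floor : ∀ N → E 0 (suc N) ≈ up 0 * E 1 N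
      first-step : ∀ y N → E (suc y) N ≈ up (suc y) * shift (E (suc (suc y))) N + down y * E y N

  module ContinuedFraction (h : ℕ) (1≤h : 1 ≤ h) (up down : ℕ → Carrier) (up-top : up h ≈ 0#) where

    loop : ℕ → Carrier
    loop k = up k * down k

    denominator : ℕ → Carrier
    denominator = continuant loop (suc h)

    record Solves (Z : ℕ → ℕ → Carrier) : Set ℓ where
      field
        origin : Z 0 0 ≈ denominator 0
        floor : ∀ N → Z 0 (suc N) ≈ denominator (suc N) + up 0 * Z 1 N
        level : ∀ y N → suc y ≤ h → Z (suc y) N ≈ up (suc y) * shift (Z (suc (suc y))) N + down y * Z y N

    open Solves

    up≈0 : ∀ {y} → y ≡ h → up y ≈ 0#
    up≈0 ≡.refl = up-top

    top-level : ∀ {y} → suc y ≤ h → ¬ suc (suc y) ≤ h → suc y ≡ h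
    top-level y<h y+1≮h = ℕ.≤-antisym y<h (ℕ.≮⇒≥ y+1≮h)

    solution-unique : ∀ {Z Z'} → Solves Z → Solves Z' → ∀ N y → y ≤ h → Z y N ≈ Z' y N
    solution-unique {Z} {Z'} S S' = go
      where
      -- Z (y + 2) only enters shifted, i.e. at a smaller N.
      go : ∀ N y → y ≤ h → Z y N ≈ Z' y N
      go zero zero _ = trans (origin S) (sym (origin S'))
      go (suc N) zero _ = trans (floor S N) (trans (+-congˡ (*-congˡ (go N 1 1≤h))) (sym (floor S' N)))
      go N (suc y) y<h =
        trans (level S y N y<h) (trans (+-cong (from-above N) (*-congˡ (go N y (ℕ.<⇒≤ y<h)))) (sym (level S' y N y<h)))
        where
        from-above : ∀ N → up (suc y) * shift (Z (suc (suc y))) N ≈ up (suc y) * shift (Z' (suc (suc y))) N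
        from-above zero = refl
        from-above (suc M) with suc (suc y) ℕ.≤? h
        ... | yes y+1<h = *-congˡ (go M (suc (suc y)) y+1<h)
        ... | no y+1≮h = trans (*-congʳ up≈0') (trans (zeroˡ _) (sym (trans (*-congʳ up≈0') (zeroˡ _))))
          where up≈0' = up≈0 (top-level y<h y+1≮h)

    denominator*walks-solves : ∀ {E} → IsWalkSeries up down E → Solves (λ y → prodCoeff denominator (E y))
    denominator*walks-solves {E} isE = record
      { origin = trans (*-congˡ empty-walk) (*-identityʳ _)
      ; floor = λ N → begin
          prodCoeff D (E 0) (suc N)
        ≈⟨ prodCoeff-sucʳ D (E 0) N ⟩
          prodCoeff D (E 0 ∘ suc) N + D (suc N) * E 0 0
        ≈⟨ +-cong (prodCoeff-congʳ D up-from-floor N) (trans (*-congˡ empty-walk) (*-identityʳ _)) ⟩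
          prodCoeff D (λ n → up 0 * E 1 n) N + D (suc N)
        ≈⟨ trans (+-congʳ (prodCoeff-*ʳ D (up 0) (E 1) N)) (+-comm _ _) ⟩
          D (suc N) + up 0 * prodCoeff D (E 1) N
        ∎
      ; level = λ y N _ → begin
          prodCoeff D (E (suc y)) N
        ≈⟨ prodCoeff-congʳ D (first-step y) N ⟩
          prodCoeff D (λ n → up (suc y) * shift (E (suc (suc y))) n + down y * E y n) N
        ≈⟨ prodCoeff-+ʳ D (λ n → up (suc y) * shift (E (suc (suc y))) n) (λ n → down y * E y n) N ⟩
          prodCoeff D (λ n → up (suc y) * shift (E (suc (suc y))) n) N + prodCoeff D (λ n → down y * E y n) N
        ≈⟨ +-cong (prodCoeff-*ʳ D (up (suc y)) (shift (E (suc (suc y)))) N) (prodCoeff-*ʳ D (down y) (E y) N) ⟩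
          up (suc y) * prodCoeff D (shift (E (suc (suc y)))) N + down y * prodCoeff D (E y) N
        ≈⟨ +-congʳ (*-congˡ (prodCoeff-shiftʳ D (E (suc (suc y))) N)) ⟩
          up (suc y) * shift (prodCoeff D (E (suc (suc y)))) N + down y * prodCoeff D (E y) N
        ∎
      }
      where
      open IsWalkSeries isE
      D = denominator

    descent : ℕ → Carrier
    descent zero = 1#
    descent (suc y) = descent y * down y

    numerator : ℕ → ℕ → Carrier
    numerator y n = descent y * continuant (drop (suc y) loop) (h ∸ y) n

    numerator-at-depth : ∀ y {L} → h ∸ y ≡ L → ∀ n →
      numerator y n ≈ descent y * continuant (drop (suc y) loop) L n
    numerator-at-depth y h∸y≡L n =
      reflexive (≡.cong (λ L → descent y * continuant (drop (suc y) loop) L n) h∸y≡L)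

    numerator-solves : Solves numerator
    numerator-solves = record
      { origin = trans (*-identityˡ _) (trans (continuant-at-0 _ h) (sym (continuant-at-0 loop (suc h))))
      ; floor = numerator-floor
      ; level = numerator-level
      }
      where
      numerator-floor : ∀ N → numerator 0 (suc N) ≈ denominator (suc N) + up 0 * numerator 1 N
      numerator-floor N = sym (begin
          denominator (suc N) + up 0 * numerator 1 N
        ≈⟨ +-cong (reflexive (continuant-unfold loop h (suc N) 1≤h))
                  (trans (*-congˡ (*-congʳ (*-identityˡ (down 0)))) (sym (*-assoc _ _ _))) ⟩
          (A - loop 0 * K) + loop 0 * K
        ≈⟨ //-rightDividesˡ (loop 0 * K) A ⟩
          A
        ≈⟨ *-identityˡ A ⟨
          numerator 0 (suc N)
        ∎)
        where
        A = continuant (loop ∘ suc) h (suc N)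
        K = continuant (loop ∘ suc ∘ suc) (h ∸ 1) N

      regroup : ∀ π d u d₁ A B → u * ((π * d * d₁) * B) + d * (π * (A - (u * d₁) * B)) ≈ (π * d) * A
      regroup π d u d₁ A B = begin
          u * ((π * d * d₁) * B) + d * (π * (A - (u * d₁) * B))
        ≈⟨ +-cong (trans (*-congˡ (*-assoc _ d₁ B))
                         (trans (*CS.x∙yz≈y∙xz u _ _) (*-congˡ (sym (*-assoc u d₁ B)))))
                  (trans (*CS.x∙yz≈yx∙z d π _) (x[y-z]≈xy-xz _ A _)) ⟩
          Y + ((π * d) * A - Y)
        ≈⟨ trans (+-comm Y _) (//-rightDividesˡ Y _) ⟩
          (π * d) * A
        ∎
        where Y = (π * d) * ((u * d₁) * B)

      numerator-level : ∀ y N → suc y ≤ h →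
        numerator (suc y) N ≈ up (suc y) * shift (numerator (suc (suc y))) N + down y * numerator y N
      numerator-level y N y<h with suc (suc y) ℕ.≤? h
      ... | yes y+1<h = sym (begin
          up (suc y) * shift (numerator (suc (suc y))) N + down y * numerator y N
        ≈⟨ +-cong (*-congˡ (shift-*ˡ (descent (suc (suc y))) _ N))
                  (*-congˡ (trans (numerator-at-depth y h∸y≡2+r N)
                                  (*-congˡ (+-congˡ (-‿cong (*-congʳ (reflexive (drop-head (suc y) loop)))))))) ⟩
          up (suc y) * (descent (suc (suc y)) * B) + down y * (descent y * (A' - loop (suc y) * B))
        ≈⟨ regroup (descent y) (down y) (up (suc y)) (down (suc y)) A' B ⟩
          descent (suc y) * A'
        ≈⟨ numerator-at-depth (suc y) h∸y+1≡1+r N ⟨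
          numerator (suc y) N
        ∎)
        where
        r = h ∸ suc (suc y)
        h∸y+1≡1+r = ∸≡suc∸suc y+1<h
        h∸y≡2+r = ≡.trans (∸≡suc∸suc y<h) (≡.cong suc h∸y+1≡1+r)
        A' = continuant (drop (suc (suc y)) loop) (suc r) N
        B = shift (continuant (drop (suc (suc (suc y))) loop) r) N
      ... | no y+1≮h = begin
          numerator (suc y) N
        ≈⟨ numerator-at-depth (suc y) h∸y+1≡0 N ⟩
          (descent y * down y) * 1ₛ N
        ≈⟨ *CS.x∙yz≈yx∙z (down y) (descent y) (1ₛ N) ⟨
          down y * (descent y * 1ₛ N)
        ≈⟨ +-identityˡ _ ⟨
          0# + down y * (descent y * 1ₛ N)
        ≈⟨ +-cong (trans (*-congʳ (up≈0 y+1≡h)) (zeroˡ _)) (*-congˡ (numerator-at-depth y h∸y≡1 N)) ⟨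
          up (suc y) * shift (numerator (suc (suc y))) N + down y * numerator y N
        ∎
        where
        y+1≡h = top-level y<h y+1≮h
        h∸y+1≡0 = ≡.trans (≡.cong (_∸ suc y) (≡.sym y+1≡h)) (ℕ.n∸n≡0 (suc y))
        h∸y≡1 = ≡.trans (∸≡suc∸suc y<h) (≡.cong suc h∸y+1≡0)

    denominator*walks≈numerator : ∀ {E} → IsWalkSeries up down E → ∀ N →
      prodCoeff denominator (E 0) N ≈ continuant (loop ∘ suc) h N
    denominator*walks≈numerator isE N =
      trans (solution-unique (denominator*walks-solves isE) numerator-solves N 0 z≤n) (*-identityˡ _)

module DyckPaths {c ℓ} (R : CommutativeRing c ℓ) where
  open CommutativeRing R
  open Dyck R
  open PowerSeries R
  open BoundedWalks R
  open AbelianGroupProperties +-abelianGroup using (⁻¹-∙-comm)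
  open import Relation.Binary.Reasoning.Setoid setoid

  if-∧-* : ∀ b₁ b₂ {x y z} →
    (if b₁ ∧ b₂ then x * (y * z) else 0#) ≈ (if b₁ then x * y else 0#) * (if b₂ then z else 0#)
  if-∧-* false b₂ = sym (zeroˡ _)
  if-∧-* true true = sym (*-assoc _ _ _)
  if-∧-* true false = sym (zeroʳ _)

  if-*ˡ : ∀ b {x y} → (if b then x * y else 0#) ≈ x * (if b then y else 0#)
  if-*ˡ true = refl
  if-*ˡ false = sym (zeroʳ _)

  sumList-++ : ∀ xs ys → sumList (xs ++ ys) ≈ sumList xs + sumList ys
  sumList-++ [] ys = sym (+-identityˡ _)
  sumList-++ (x ∷ xs) ys = trans (+-congˡ (sumList-++ xs ys)) (sym (+-assoc _ _ _))

  sumList-map-scale : ∀ {a} {A : Set a} (f g : A → Carrier) (k : A → A) x → (∀ s → f (k s) ≈ x * g s) →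
    ∀ L → sumList (map f (map k L)) ≈ x * sumList (map g L)
  sumList-map-scale f g k x fk≈xg [] = sym (zeroʳ x)
  sumList-map-scale f g k x fk≈xg (s ∷ L) =
    trans (+-cong (fk≈xg s) (sumList-map-scale f g k x fk≈xg L)) (sym (distribˡ x _ _))

  Qweight : Carrier → Carrier → ℕ → Carrier
  Qweight q a zero = a
  Qweight q a (suc k) = q ^ suc k

  mutual
    Q≈continuant-split : ∀ q m a b n →
      Q q (suc m) a b n ≈ continuant (Qweight q a) (suc m) n - (b * Qweight q a m) * shift (continuant (Qweight q a) m) n
    Q≈continuant-split q zero a b zero = sym (x-y*0≈x 1# _)
    Q≈continuant-split q zero a b (suc zero) =
      sym (trans (+-identityˡ _) (-‿cong (trans (*-identityʳ _) (*-comm b a))))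
    Q≈continuant-split q zero a b (suc (suc n)) = sym (x-y*0≈x 0# _)
    Q≈continuant-split q (suc zero) a b zero = sym (trans (x-y*0≈x _ _) (x-y*0≈x 1# a))
    Q≈continuant-split q (suc zero) a b (suc zero) = sym (begin
        (0# - a * 1#) - (b * (q * 1#)) * 1#
      ≈⟨ +-cong (trans (+-identityˡ _) (-‿cong (*-identityʳ a)))
                (-‿cong (trans (*-identityʳ _) (*-congˡ (*-identityʳ q)))) ⟩
        - a - b * q
      ≈⟨ ⁻¹-∙-comm a (b * q) ⟩
        - (a + b * q)
      ∎)
    Q≈continuant-split q (suc zero) a b (suc (suc n)) = sym (trans (x-y*0≈x _ _) (x-y*0≈x 0# a))
    Q≈continuant-split q (suc (suc m)) a b n =
      +-cong (Q[b=1]≈continuant q (suc m) a n) (-‿cong (*-congˡ (shift-cong (Q[b=1]≈continuant q m a) n)))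

    Q[b=1]≈continuant : ∀ q m a n → Q q (suc m) a 1# n ≈ continuant (Qweight q a) (suc (suc m)) n
    Q[b=1]≈continuant q m a n =
      trans (Q≈continuant-split q m a 1# n)
            (trans (+-congˡ (-‿cong (*-congʳ (*-identityˡ _)))) (sym (continuant-expandʳ (Qweight q a) m n)))

  module DyckSteps (h : ℕ) (a b q : Carrier) where

    atFloor : ℕ → Carrier
    atFloor y = if y ≡ᵇ 0 then a else 1#

    atCeiling : ℕ → Carrier
    atCeiling y = if y ≡ᵇ h then b else 1#

    upStep : ℕ → Carrier
    upStep y = if y <ᵇ h then q ^ y * vertexFactor h a b q (suc y) else 0#

    downStep : ℕ → Carrier
    downStep = vertexFactor h a b q

    loop : ℕ → Carrier
    loop k = upStep k * downStep k

    upStep-top : upStep h ≈ 0#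
    upStep-top = reflexive (if-false (λ h<h → ℕ.<-irrefl ≡.refl (ℕ.<ᵇ⇒< h h h<h)))

    atCeiling-below : ∀ {y} → y < h → atCeiling y ≡ 1#
    atCeiling-below {y} y<h = if-false (λ y≡h → ℕ.<⇒≢ y<h (ℕ.≡ᵇ⇒≡ y h y≡h))

    loop-below : ∀ k → k < h → loop k ≈ Qweight q a k * atCeiling (suc k)
    loop-below k k<h =
      trans (*-cong (reflexive (if-true (ℕ.<⇒<ᵇ k<h))) (*-congˡ (reflexive (atCeiling-below k<h)))) (regroup k)
      where
      regroup : ∀ k → (q ^ k * (1# * atCeiling (suc k))) * (atFloor k * 1#) ≈ Qweight q a k * atCeiling (suc k)
      regroup zero = trans (*-cong (trans (*-identityˡ _) (*-identityˡ _)) (*-identityʳ a)) (*-comm _ a)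
      regroup (suc k) = trans (*-cong (*-congˡ (*-identityˡ _)) (*-identityʳ 1#)) (*-identityʳ _)

    loop≈Qweight : ∀ k → suc k < h → loop k ≈ Qweight q a k
    loop≈Qweight k k+1<h =
      trans (loop-below k (ℕ.<-trans (ℕ.n<1+n k) k+1<h))
            (trans (*-congˡ (reflexive (atCeiling-below k+1<h))) (*-identityʳ _))

    loop-top : ∀ k → suc k ≡ h → loop k ≈ b * Qweight q a k
    loop-top k k+1≡h =
      trans (loop-below k (ℕ.≤-reflexive k+1≡h))
            (trans (*-congˡ (reflexive (if-true (ℕ.≡⇒≡ᵇ _ _ k+1≡h)))) (*-comm _ b))

  module DyckWalks (h : ℕ) (a b q : Carrier) where
    open DyckSteps h a b q

    dyckTerm : ℕ → List Bool → Carrier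
    dyckTerm y s = if isDyck h y s then weight h a b q y s else 0#

    walkSum : ℕ → ℕ → Carrier
    walkSum y n = sumList (map (dyckTerm y) (allSteps n))

    walkSum-suc : ∀ y n →
      walkSum y (suc n) ≈ upStep y * walkSum (suc y) n + sumList (map (dyckTerm y) (map (false ∷_) (allSteps n)))
    walkSum-suc y n =
      trans (reflexive (≡.cong sumList (map-++ (dyckTerm y) ups downs)))
            (trans (sumList-++ (map (dyckTerm y) ups) (map (dyckTerm y) downs))
                   (+-congʳ (sumList-map-scale (dyckTerm y) (dyckTerm (suc y)) (true ∷_) (upStep y)
                                               (λ s → if-∧-* (y <ᵇ h) (isDyck h (suc y) s)) (allSteps n))))
      where
      ups = map (true ∷_) (allSteps n)
      downs = map (false ∷_) (allSteps n)

    walkSum-suc-floor : ∀ n → walkSum 0 (suc n) ≈ upStep 0 * walkSum 1 n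
    walkSum-suc-floor n =
      trans (walkSum-suc 0 n)
            (trans (+-congˡ (trans (sumList-map-scale (dyckTerm 0) (dyckTerm 0) (false ∷_) 0#
                                                      (λ _ → sym (zeroˡ _)) (allSteps n))
                                   (zeroˡ _)))
                   (+-identityʳ _))

    walkSum-suc-level : ∀ y n →
      walkSum (suc y) (suc n) ≈ upStep (suc y) * walkSum (suc (suc y)) n + downStep y * walkSum y n
    walkSum-suc-level y n =
      trans (walkSum-suc (suc y) n)
            (+-congˡ (sumList-map-scale (dyckTerm (suc y)) (dyckTerm y) (false ∷_) (downStep y)
                                        (λ s → if-*ˡ (isDyck h y s)) (allSteps n)))

    walkSum-short : ∀ n y → n < y → walkSum y n ≈ 0#
    walkSum-short zero (suc y) _ = +-identityʳ 0#
    walkSum-short (suc n) (suc y) (s≤s n<y) =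
      trans (walkSum-suc-level y n)
            (trans (+-cong (*-congˡ (walkSum-short n (suc (suc y)) (ℕ.m<n⇒m<1+n (ℕ.m<n⇒m<1+n n<y))))
                           (*-congˡ (walkSum-short n y n<y)))
                   (trans (+-cong (zeroʳ _) (zeroʳ _)) (+-identityʳ 0#)))

    walkSeries : ℕ → ℕ → Carrier
    walkSeries y N = walkSum y (y Nat.+ (N Nat.+ N))

    walkSeries-isWalkSeries : IsWalkSeries upStep downStep walkSeries
    walkSeries-isWalkSeries = record
      { empty-walk = +-identityʳ 1#
      ; up-from-floor = λ N →
          trans (walkSum-suc-floor (N Nat.+ suc N)) (*-congˡ (reflexive (≡.cong (walkSum 1) (ℕ.+-suc N N))))
      ; first-step = λ y N → trans (walkSum-suc-level y (y Nat.+ (N Nat.+ N))) (+-congʳ (*-congˡ (up-then-walk y N)))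
      }
      where
      up-then-walk : ∀ y N → walkSum (suc (suc y)) (y Nat.+ (N Nat.+ N)) ≈ shift (walkSeries (suc (suc y))) N
      up-then-walk y zero =
        walkSum-short (y Nat.+ 0) (suc (suc y)) (s≤s (ℕ.m≤n⇒m≤1+n (ℕ.≤-reflexive (ℕ.+-identityʳ y))))
      up-then-walk y (suc M) = reflexive (≡.cong (walkSum (suc (suc y)))
        (≡.trans (ℕ.+-suc y (M Nat.+ suc M))
                 (≡.cong suc (≡.trans (≡.cong (y Nat.+_) (ℕ.+-suc M M)) (ℕ.+-suc y (M Nat.+ M))))))

  Q≈continuant : ∀ m a b q n → Q q (suc m) a b n ≈ continuant (DyckSteps.loop (suc m) a b q) (suc (suc m)) n
  Q≈continuant m a b q n = begin
      Q q (suc m) a b n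
    ≈⟨ Q≈continuant-split q m a b n ⟩
      continuant (Qweight q a) (suc m) n - (b * Qweight q a m) * shift (continuant (Qweight q a) m) n
    ≈⟨ +-cong (continuant-cong (suc m) agree n)
              (-‿cong (*-cong (sym (loop-top m ≡.refl))
                              (shift-cong (continuant-cong m (λ j j+1<m → agree j (ℕ.m<n⇒m<1+n j+1<m))) n))) ⟩
      continuant loop (suc m) n - loop m * shift (continuant loop m) n
    ≈⟨ continuant-expandʳ loop m n ⟨
      continuant loop (suc (suc m)) n
    ∎
    where
    open DyckSteps (suc m) a b q
    agree : ∀ j → suc j < suc m → Qweight q a j ≈ loop j
    agree j j+1<h = sym (loop≈Qweight j j+1<h)

proposition4 : ∀ {c ℓ} (R : CommutativeRing c ℓ) (a b q : CommutativeRing.Carrier R) (h : ℕ) → 1 ≤ h →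
    ∀ (N : ℕ) → CommutativeRing._≈_ R
      (Dyck.prodCoeff R (Dyck.Q R q h a b) (Dyck.Dcoeff R h a b q) N)
      (Dyck.Q R q h (CommutativeRing.0# R) b N)
proposition4 R a b q h@(suc m) 1≤h N = begin
    prodCoeff (Q q h a b) (Dcoeff h a b q) N
  ≈⟨ prodCoeff-congˡ (walkSeries 0) (Q≈continuant m a b q) N ⟩
    prodCoeff (continuant (loop a) (suc h)) (walkSeries 0) N
  ≈⟨ denominator*walks≈numerator walkSeries-isWalkSeries N ⟩
    continuant (loop 0# ∘ suc) h N
  ≈⟨ continuant-head-0 (loop 0#) m N loop₀≈0 ⟨
    continuant (loop 0#) (suc h) N
  ≈⟨ Q≈continuant m 0# b q N ⟨
    Q q h 0# b N
  ∎
  where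
  open CommutativeRing R
  open Dyck R
  open PowerSeries R
  open BoundedWalks R
  open DyckPaths R
  open DyckWalks h a b q
  open DyckSteps h a b q using (upStep; downStep; upStep-top)
  open ContinuedFraction h 1≤h upStep downStep upStep-top using (denominator*walks≈numerator)
  open import Relation.Binary.Reasoning.Setoid setoid
  loop : Carrier → ℕ → Carrier
  loop a' = DyckSteps.loop h a' b q
  loop₀≈0 : loop 0# 0 ≈ 0#
  loop₀≈0 = trans (*-congˡ (zeroˡ _)) (zeroʳ _)
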